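{- Let $n$ be a positive integer and let $c,m$ be integers with $c>0$ and $m\geq 0$. Take $\mathcal{G}=\mathbb{Z}$. Then for every $k\in\{0,1,\ldots,n-1\}$, the number of $k$-skeletal paths of height $n$ with values in $\mathbb{Z}$ for parameters $c,m$ is $$\frac{c}{(m+1)n+c}\binom{(m+1)n+c}{n}.$$
   Context: A path of height $n$ with values in $\mathbb{Z}$ is a set $\pi=\{(x_i,i): i=0,1,\ldots,n-1\}$ with $x_0\leq x_1\leq\cdots\leq x_{n-1}$ and all $x_i\in\mathbb{Z}$. For $k\in\{0,1,\ldots,n-1\}$, such a path is $k$-skeletal (for parameters $c,m$) iff: (P0) $x_0\geq 0$; (P1) $x_i<mi+c$ for all $i\in\{n-k-1,\ldots,n-1\}$; (P2) for every $i\in\{0,1,\ldots,n-k-1\}$ there exists $j\in\{i,i+1,\ldots,i+k\}$ with $x_j\geq mj$. -}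

module Defs where

open import Data.Nat using (ℕ; zero; suc)
import Data.Nat as N
open import Data.Integer using (ℤ; +_; _+_; _*_; _≤_; _<_)
open import Data.Fin using (Fin; toℕ)
open import Data.Vec using (Vec; lookup)
open import Data.Product using (Σ; _×_)
open import Relation.Binary.PropositionalEquality using (_≡_)

-- A path of height n with values in ℤ: the vector (x_0,…,x_{n-1}),
-- required to be weakly increasing.
Monotone : ∀ {n} → Vec ℤ n → Set
Monotone {n} x = (i j : Fin n) → toℕ i N.≤ toℕ j → lookup x i ≤ lookup x j

Skeletal : (c m : ℤ) (n k : ℕ) → Vec ℤ n → Set
Skeletal c m n k x =
  Monotone x
  × ((i : Fin n) → toℕ i ≡ 0 → + 0 ≤ lookup x i)
  × ((i : Fin n) → (n N.∸ k) N.∸ 1 N.≤ toℕ i → lookup x i < m * + toℕ i + c)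
  × ((i : Fin n) → toℕ i N.≤ (n N.∸ k) N.∸ 1 →
       Σ (Fin n) λ j → (toℕ i N.≤ toℕ j) × (toℕ j N.≤ toℕ i N.+ k)
                        × (m * + toℕ j ≤ lookup x j))

{-# OPTIONS --safe #-}

-- Let S(h, k, c) be the set of k-skeletal paths of height h; their values lie in ℕ by P0 and
-- monotonicity, and for height h + 1 the window of P1 is [h ∸ k, h]. A path in S(h + 1, k, c + 1)
-- either stays below m i + c on the whole window, and then lies in S(h + 1, k, c), or has a
-- first window index i with x_i ≥ m i + c, where P1 forces x_i = m i + c. Deleting x_i leaves a
-- path in S(h, k, c + 1 + m), and re-inserting m i + c at the first crossing of that path undoes
-- the deletion. So |S(h + 1, k, c + 1)| = |S(h + 1, k, c)| + |S(h, k, c + 1 + m)|, with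
-- |S(0, k, c)| = 1 and |S(h + 1, k, 0)| = 0: whatever k is, this is the recurrence of the ballot
-- numbers c / ((m + 1) h + c) · C((m + 1) h + c, h).
module Submission where

open import Defs

open import Data.Nat
  using (ℕ; zero; suc; _+_; _*_; _∸_; _≤_; _<_; _≤?_; z≤n; s≤s; s≤s⁻¹)
open import Data.Nat.Properties
open import Data.Nat.Combinatorics using (_C_; nC1≡n; nCk+nC[k+1]≡[n+1]C[k+1])
open import Data.Nat.Tactic.RingSolver using (solve-∀)
open import Data.List using (List; []; [_]; _++_; map; length)
open import Data.List.Properties using (length-++; length-map)
open import Data.List.Membership.Propositional using (_∈_)
open import Data.List.Membership.Propositional.Properties using (∈-map⁺; ∈-map⁻; ∈-++⁺ˡ; ∈-++⁺ʳ; ∈-++⁻)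
open import Data.List.Relation.Unary.Any using (here)
open import Data.List.Relation.Unary.Unique.Propositional using (Unique)
open import Data.List.Relation.Unary.AllPairs using ([]; _∷_)
open import Data.List.Relation.Unary.All using ([])
import Data.List.Relation.Unary.Unique.Propositional.Properties as Unique
open import Data.Vec using (Vec; []; _∷_; lookup)
import Data.Vec as Vec
open import Data.Vec.Properties using (lookup-map; map-∘; map-id)
open import Data.Fin using (Fin; toℕ; fromℕ<)
open import Data.Fin.Properties using (toℕ<n; toℕ-fromℕ<)
open import Data.Integer using (ℤ; +_; ∣_∣)
import Data.Integer as ℤ
import Data.Integer.Properties as ℤ
open import Function.Bundles using (_⇔_; mk⇔)
open import Data.Empty using (⊥-elim)
open import Function.Base using (_∘_)
open import Data.Product using (Σ; _×_; _,_; proj₁; proj₂; ∃-syntax)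
open import Data.Sum using (inj₁; inj₂)
open import Relation.Binary.Definitions using (tri<; tri≈; tri>)
open import Relation.Nullary using (¬_; yes; no)
open import Level using (Level; _⊔_)
open import Relation.Unary using (Pred; Decidable)
open import Relation.Binary.PropositionalEquality
  using (_≡_; refl; sym; trans; cong; cong₂; subst; subst₂; module ≡-Reasoning)

-- Out-of-range indices read as 0.
infixl 9 _!_
_!_ : ∀ {n} → Vec ℕ n → ℕ → ℕ
[]      ! _     = 0
(a ∷ v) ! zero  = a
(a ∷ v) ! suc j = v ! j

insert : ∀ {n} → ℕ → ℕ → Vec ℕ n → Vec ℕ (suc n)
insert zero    a v       = a ∷ v
insert (suc i) a []      = a ∷ []
insert (suc i) a (b ∷ v) = b ∷ insert i a v

remove : ∀ {n} → ℕ → Vec ℕ (suc n) → Vec ℕ n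
remove          zero    (a ∷ v) = v
remove {zero}   (suc i) (a ∷ v) = []
remove {suc n}  (suc i) (a ∷ v) = a ∷ remove i v

insert-!-< : ∀ {n i j} a (v : Vec ℕ n) → i ≤ n → j < i → insert i a v ! j ≡ v ! j
insert-!-< a (b ∷ v) _         (s≤s z≤n)       = refl
insert-!-< a (b ∷ v) (s≤s i≤n) (s≤s (s≤s j<i)) = insert-!-< a v i≤n (s≤s j<i)

insert-!-≡ : ∀ {n} i a (v : Vec ℕ n) → i ≤ n → insert i a v ! i ≡ a
insert-!-≡ zero    a v       _         = refl
insert-!-≡ (suc i) a (b ∷ v) (s≤s i≤n) = insert-!-≡ i a v i≤n

insert-!-> : ∀ {n i j} a (v : Vec ℕ n) → i ≤ j → insert i a v ! suc j ≡ v ! j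
insert-!-> {i = zero}              a v       _         = refl
insert-!-> {i = suc i}             a []      _         = refl
insert-!-> {i = suc i} {suc j}     a (b ∷ v) (s≤s i≤j) = insert-!-> a v i≤j

remove-!-< : ∀ {n i j} (v : Vec ℕ (suc n)) → i ≤ n → j < i → remove i v ! j ≡ v ! j
remove-!-< {suc n} (a ∷ v) _         (s≤s z≤n)       = refl
remove-!-< {suc n} (a ∷ v) (s≤s i≤n) (s≤s (s≤s j<i)) = remove-!-< v i≤n (s≤s j<i)

remove-!-≥ : ∀ {n i j} (v : Vec ℕ (suc n)) → i ≤ j → remove i v ! j ≡ v ! suc j
remove-!-≥ {i = zero}                  (a ∷ v) _         = refl
remove-!-≥ {zero}  {suc i} {suc j}     (a ∷ []) _        = refl
remove-!-≥ {suc n} {suc i} {suc j}     (a ∷ v) (s≤s i≤j) = remove-!-≥ v i≤j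

remove-insert : ∀ {n} i a (v : Vec ℕ n) → remove i (insert i a v) ≡ v
remove-insert zero    a v       = refl
remove-insert (suc i) a []      = refl
remove-insert (suc i) a (b ∷ v) = cong (b ∷_) (remove-insert i a v)

insert-remove : ∀ {n} i (v : Vec ℕ (suc n)) → i ≤ n → insert i (v ! i) (remove i v) ≡ v
insert-remove zero    (a ∷ v)         _         = refl
insert-remove (suc i) (a ∷ b ∷ v) (s≤s i≤n) = cong (a ∷_) (insert-remove i (b ∷ v) i≤n)

NonDecreasing : ∀ {n} → Vec ℕ n → Set
NonDecreasing {n} v = ∀ j → suc j < n → v ! j ≤ v ! suc j

nonDecreasing-≤ : ∀ {n} {v : Vec ℕ n} → NonDecreasing v → ∀ {i j} → i ≤ j → j < n → v ! i ≤ v ! j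
nonDecreasing-≤ nd {j = zero}  z≤n  _    = ≤-refl
nonDecreasing-≤ {v = v} nd {j = suc j} i≤sj sj<n with m≤n⇒m<n∨m≡n i≤sj
... | inj₂ refl = ≤-refl
... | inj₁ i<sj = ≤-trans (nonDecreasing-≤ {v = v} nd (s≤s⁻¹ i<sj) (<-trans (n<1+n j) sj<n)) (nd j sj<n)

remove-between : ∀ {n i j} {v : Vec ℕ (suc n)} → i ≤ n → NonDecreasing v → j < n →
                 v ! j ≤ remove i v ! j × remove i v ! j ≤ v ! suc j
remove-between {i = i} {j} {v} i≤n nd j<n with j <? i
... | yes j<i rewrite remove-!-< v i≤n j<i = ≤-refl , nd j (s≤s j<n)
... | no  j≮i rewrite remove-!-≥ v (≮⇒≥ j≮i) = nd j (s≤s j<n) , ≤-refl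

remove-nonDecreasing : ∀ {n i} {v : Vec ℕ (suc n)} → i ≤ n → NonDecreasing v → NonDecreasing (remove i v)
remove-nonDecreasing {n} {i} {v} i≤n nd j sj<n =
  ≤-trans (proj₂ (between (<-trans (n<1+n j) sj<n))) (proj₁ (between sj<n))
  where
    between : ∀ {j} → j < n → v ! j ≤ remove i v ! j × remove i v ! j ≤ v ! suc j
    between = remove-between {v = v} i≤n nd

insert-nonDecreasing : ∀ {n i a} {v : Vec ℕ n} → i ≤ n → NonDecreasing v →
                       (∀ {j} → suc j ≡ i → v ! j ≤ a) → (i < n → a ≤ v ! i) →
                       NonDecreasing (insert i a v)
insert-nonDecreasing {i = i} {a} {v} i≤n nd left right j (s≤s sj≤n) with <-cmp (suc j) i
... | tri< sj<i _ _
  rewrite insert-!-< a v i≤n sj<i | insert-!-< a v i≤n (<-trans (n<1+n j) sj<i) = nd j (<-≤-trans sj<i i≤n)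
... | tri≈ _ refl _
  rewrite insert-!-< a v i≤n (n<1+n j) | insert-!-≡ i a v i≤n = left refl
... | tri> _ _ (s≤s i≤j) with m≤n⇒m<n∨m≡n i≤j
...   | inj₂ refl rewrite insert-!-≡ i a v i≤n | insert-!-> a v (≤-refl {i}) = right sj≤n
...   | inj₁ i<j with j
...     | suc j′ rewrite insert-!-> a v (s≤s⁻¹ i<j) | insert-!-> a v i≤j = nd j′ sj≤n

record FirstIn {p} (P : Pred ℕ p) (s t r : ℕ) : Set p where
  field
    lower  : s ≤ r
    upper  : r ≤ t
    misses : ∀ {j} → s ≤ j → j < r → ¬ P j
    hits   : r < t → P r

module _ {p : Level} {P : Pred ℕ p} where

  FirstIn-unique : ∀ {s t r r′} → FirstIn P s t r → FirstIn P s t r′ → r ≡ r′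
  FirstIn-unique {r = r} {r′} F G with <-cmp r r′
  ... | tri< r<r′ _ _ = ⊥-elim (misses G (lower F) r<r′ (hits F (<-≤-trans r<r′ (upper G))))
    where open FirstIn
  ... | tri≈ _ r≡r′ _ = r≡r′
  ... | tri> _ _ r′<r = ⊥-elim (misses F (lower G) r′<r (hits G (<-≤-trans r′<r (upper F))))
    where open FirstIn

  module _ (P? : Decidable P) where

    search : ℕ → ℕ → ℕ
    search s zero    = s
    search s (suc d) with P? s
    ... | yes _ = s
    ... | no  _ = search (suc s) d

    search-FirstIn : ∀ s d → FirstIn P s (s + d) (search s d)
    search-FirstIn s zero = record
      { lower  = ≤-refl
      ; upper  = m≤m+n s 0
      ; misses = λ s≤j j<s → ⊥-elim (<⇒≱ j<s s≤j)
      ; hits   = λ s<s+0 → ⊥-elim (<-irrefl (sym (+-identityʳ s)) s<s+0)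
      }
    search-FirstIn s (suc d) with P? s
    ... | yes Ps = record
      { lower  = ≤-refl
      ; upper  = m≤m+n s (suc d)
      ; misses = λ s≤j j<s → ⊥-elim (<⇒≱ j<s s≤j)
      ; hits   = λ _ → Ps
      }
    ... | no ¬Ps = record
      { lower  = ≤-trans (n≤1+n s) lower
      ; upper  = subst (search (suc s) d ≤_) (sym (+-suc s d)) upper
      ; misses = misses′
      ; hits   = λ r<t → hits (subst (search (suc s) d <_) (+-suc s d) r<t)
      }
      where
        open FirstIn (search-FirstIn (suc s) d)
        misses′ : ∀ {j} → s ≤ j → j < search (suc s) d → ¬ P j
        misses′ s≤j j<r with m≤n⇒m<n∨m≡n s≤j
        ... | inj₁ s<j  = misses s<j j<r
        ... | inj₂ refl = ¬Ps

    first : ℕ → ℕ → ℕ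
    first s t = search s (t ∸ s)

    first-FirstIn : ∀ {s t} → s ≤ t → FirstIn P s t (first s t)
    first-FirstIn {s} {t} s≤t =
      subst (λ t′ → FirstIn P s t′ (first s t)) (m+[n∸m]≡n s≤t) (search-FirstIn s (t ∸ s))

record Enumerates {a p} {A : Set a} (L : List A) (P : Pred A p) : Set (a ⊔ p) where
  field
    unique   : Unique L
    sound    : ∀ {x} → x ∈ L → P x
    complete : ∀ {x} → P x → x ∈ L

enumerates-map : ∀ {a b p q} {A : Set a} {B : Set b} {P : Pred A p} {Q : Pred B q} {f : A → B} {L : List A} →
  (∀ {x y} → f x ≡ f y → x ≡ y) → (∀ {x} → P x → Q (f x)) →
  (∀ {y} → Q y → ∃[ x ] P x × f x ≡ y) → Enumerates L P → Enumerates (map f L) Q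
enumerates-map {Q = Q} {f = f} {L} f-injective P⇒Q Q⇒P E = record
  { unique   = Unique.map⁺ f-injective unique
  ; sound    = sound′
  ; complete = λ Qy → let x , Px , fx≡y = Q⇒P Qy in subst (_∈ _) fx≡y (∈-map⁺ f (complete Px))
  }
  where
    open Enumerates E
    sound′ : ∀ {y} → y ∈ map f L → Q y
    sound′ y∈ with ∈-map⁻ f y∈
    ... | x , x∈L , refl = P⇒Q (sound x∈L)

[k+1]*[n+1]C[k+1]≡[n+1]*nCk : ∀ n k → suc k * (suc n C suc k) ≡ suc n * (n C k)
[k+1]*[n+1]C[k+1]≡[n+1]*nCk zero    zero    = refl
[k+1]*[n+1]C[k+1]≡[n+1]*nCk zero    (suc k) = *-zeroʳ (suc (suc k))
[k+1]*[n+1]C[k+1]≡[n+1]*nCk (suc n) zero    =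
  trans (trans (*-identityˡ _) (nC1≡n (suc (suc n)))) (sym (*-identityʳ (suc (suc n))))
[k+1]*[n+1]C[k+1]≡[n+1]*nCk (suc n) (suc k) = begin
  suc (suc k) * (suc (suc n) C suc (suc k))  ≡⟨ cong (suc (suc k) *_) (nCk+nC[k+1]≡[n+1]C[k+1] (suc n) (suc k)) ⟨
  suc (suc k) * (P + Q)                      ≡⟨ rearrange k P Q ⟩
  P + (suc k * P + suc (suc k) * Q)
    ≡⟨ cong₂ (λ x y → P + (x + y)) ([k+1]*[n+1]C[k+1]≡[n+1]*nCk n k) ([k+1]*[n+1]C[k+1]≡[n+1]*nCk n (suc k)) ⟩
  P + (suc n * (n C k) + suc n * (n C suc k)) ≡⟨ cong (λ u → P + u) (*-distribˡ-+ (suc n) (n C k) (n C suc k)) ⟨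
  P + suc n * (n C k + n C suc k)            ≡⟨ cong (λ x → P + suc n * x) (nCk+nC[k+1]≡[n+1]C[k+1] n k) ⟩
  suc (suc n) * P                            ∎
  where
    open ≡-Reasoning
    P Q : ℕ
    P = suc n C suc k
    Q = suc n C suc (suc k)
    rearrange : ∀ k P Q → suc (suc k) * (P + Q) ≡ P + (suc k * P + suc (suc k) * Q)
    rearrange = solve-∀

[k+1]*[k+r]C[k+1]≡r*[k+r]Ck : ∀ k r → suc k * ((k + r) C suc k) ≡ r * ((k + r) C k)
[k+1]*[k+r]C[k+1]≡r*[k+r]Ck k r = +-cancelˡ-≡ (suc k * A) _ _ (begin
  suc k * A + suc k * B        ≡⟨ *-distribˡ-+ (suc k) A B ⟨
  suc k * (A + B)              ≡⟨ cong (suc k *_) (nCk+nC[k+1]≡[n+1]C[k+1] (k + r) k) ⟩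
  suc k * (suc (k + r) C suc k) ≡⟨ [k+1]*[n+1]C[k+1]≡[n+1]*nCk (k + r) k ⟩
  (suc k + r) * A              ≡⟨ *-distribʳ-+ A (suc k) r ⟩
  suc k * A + r * A            ∎)
  where
    open ≡-Reasoning
    A B : ℕ
    A = (k + r) C k
    B = (k + r) C suc k

-- With N = (m + 1)(h + 1) + c and r = m (h + 1) + c + 1 (so h + 1 + r = N + 1), multiplying by
-- h + 1 and substituting (h + 1) B = r A reduces this to c r + (m + c + 1)(h + 1) = (c + 1) N.
ballot-core : ∀ m h c A B → suc h * B ≡ (m * suc h + suc c) * A →
  (c * B + (m + suc c) * A) * suc (suc m * suc h + c) ≡ suc c * (A + B) * (suc m * suc h + c)
ballot-core m h c A B [h+1]B≡rA = *-cancelˡ-≡ _ _ (suc h) (begin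
  suc h * ((c * B + (m + suc c) * A) * suc N)          ≡⟨ expand m h c A B ⟩
  (c * (suc h * B) + (m + suc c) * suc h * A) * suc N  ≡⟨ cong (λ u → (c * u + (m + suc c) * suc h * A) * suc N)
                                                            [h+1]B≡rA ⟩
  (c * (r * A) + (m + suc c) * suc h * A) * suc N      ≡⟨ identity m h c A ⟩
  suc c * (suc h * A + r * A) * N                      ≡⟨ cong (λ u → suc c * (suc h * A + u) * N) [h+1]B≡rA ⟨
  suc c * (suc h * A + suc h * B) * N                  ≡⟨ collect m h c A B ⟩
  suc h * (suc c * (A + B) * N)                        ∎)
  where
    open ≡-Reasoning
    N r : ℕ
    N = suc m * suc h + c
    r = m * suc h + suc c
    expand : ∀ m h c A B → let N = suc m * suc h + c in
      suc h * ((c * B + (m + suc c) * A) * suc N) ≡ (c * (suc h * B) + (m + suc c) * suc h * A) * suc N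
    expand = solve-∀
    identity : ∀ m h c A → let N = suc m * suc h + c ; r = m * suc h + suc c in
      (c * (r * A) + (m + suc c) * suc h * A) * suc N ≡ suc c * (suc h * A + r * A) * N
    identity = solve-∀
    collect : ∀ m h c A B → let N = suc m * suc h + c in
      suc c * (suc h * A + suc h * B) * N ≡ suc h * (suc c * (A + B) * N)
    collect = solve-∀

IsBallot : (m h c x : ℕ) → Set
IsBallot m h c x = x * (suc m * h + c) ≡ c * ((suc m * h + c) C h)

isBallot-zero : ∀ m c → IsBallot m 0 c 1
isBallot-zero m c = begin
  1 * (m * 0 + c)  ≡⟨ *-identityˡ _ ⟩
  m * 0 + c        ≡⟨ cong (_+ c) (*-zeroʳ m) ⟩
  c                ≡⟨ *-identityʳ c ⟨
  c * 1            ∎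
  where open ≡-Reasoning

ballot-step : ∀ m h c {x y} → IsBallot m (suc h) c x → IsBallot m h (m + suc c) y →
              IsBallot m (suc h) (suc c) (x + y)
ballot-step m h c {x} {y} x-ballot y-ballot =
  subst (λ n → (x + y) * n ≡ suc c * (n C suc h)) (sym (+-suc (suc m * suc h) c)) (*-cancelʳ-≡ _ _ N (begin
    (x + y) * suc N * N                ≡⟨ distrib x y N ⟩
    (x * N + y * N) * suc N            ≡⟨ cong₂ (λ u v → (u + v) * suc N) x-ballot y-ballot′ ⟩
    (c * B + (m + suc c) * A) * suc N  ≡⟨ ballot-core m h c A B [h+1]B≡rA ⟩
    suc c * (A + B) * N                ≡⟨ cong (λ u → suc c * u * N) (nCk+nC[k+1]≡[n+1]C[k+1] N h) ⟩
    suc c * (suc N C suc h) * N        ∎))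
  where
    open ≡-Reasoning
    N A B : ℕ
    N = suc m * suc h + c
    A = N C h
    B = N C suc h
    N≡h+r : ∀ m h c → suc m * suc h + c ≡ h + (m * suc h + suc c)
    N≡h+r = solve-∀
    N≡[m+1]h+[m+1+c] : ∀ m h c → suc m * h + (m + suc c) ≡ suc m * suc h + c
    N≡[m+1]h+[m+1+c] = solve-∀
    distrib : ∀ x y N → (x + y) * suc N * N ≡ (x * N + y * N) * suc N
    distrib = solve-∀
    y-ballot′ : y * N ≡ (m + suc c) * A
    y-ballot′ = subst (λ n → y * n ≡ (m + suc c) * (n C h)) (N≡[m+1]h+[m+1+c] m h c) y-ballot
    [h+1]B≡rA : suc h * B ≡ (m * suc h + suc c) * A
    [h+1]B≡rA = subst (λ n → suc h * (n C suc h) ≡ (m * suc h + suc c) * (n C h)) (sym (N≡h+r m h c))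
                  ([k+1]*[k+r]C[k+1]≡r*[k+r]Ck h (m * suc h + suc c))

m∸n≤1+m∸[1+n] : ∀ m n → m ∸ n ≤ suc (m ∸ suc n)
m∸n≤1+m∸[1+n] zero    n       = subst (_≤ 1) (sym (0∸n≡0 n)) z≤n
m∸n≤1+m∸[1+n] (suc m) zero    = ≤-refl
m∸n≤1+m∸[1+n] (suc m) (suc n) = m∸n≤1+m∸[1+n] m n

1+m≤n∸[1+o]⇒1+m+o<n : ∀ {m n} o → suc m ≤ n ∸ suc o → suc m + o < n
1+m≤n∸[1+o]⇒1+m+o<n {m} {suc n} zero    le = s≤s (subst (_≤ n) (sym (+-identityʳ (suc m))) le)
1+m≤n∸[1+o]⇒1+m+o<n {m} {suc n} (suc o) le =
  subst (_< suc n) (sym (+-suc (suc m) o)) (s≤s (1+m≤n∸[1+o]⇒1+m+o<n o le))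

m∸n≤1+o⇒m∸[1+n]≤o : ∀ m n {o} → m ∸ n ≤ suc o → m ∸ suc n ≤ o
m∸n≤1+o⇒m∸[1+n]≤o m n {o} le = subst (_≤ o) (pred[m∸n]≡m∸[1+n] m n) (pred-mono-≤ le)

[m∸n]∸1≡m∸[1+n] : ∀ m n → (m ∸ n) ∸ 1 ≡ m ∸ suc n
[m∸n]∸1≡m∸[1+n] m n = trans (∸-+-assoc m n 1) (cong (m ∸_) (+-comm n 1))

m*[1+j]+c≡m*j+[m+c] : ∀ m j c → m * suc j + c ≡ m * j + (m + c)
m*[1+j]+c≡m*j+[m+c] = solve-∀

module SkeletalPaths (m : ℕ) where

  -- Skeletal on ℕ-valued paths, where P0 is automatic; a < h in reaches mirrors i : Fin n in P2.
  record Skeletalℕ {h} (k c : ℕ) (v : Vec ℕ h) : Set where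
    field
      nonDecreasing : NonDecreasing v
      below         : ∀ j → h ∸ suc k ≤ j → j < h → v ! j < m * j + c
      reaches       : ∀ a → a ≤ h ∸ suc k → a < h →
                      ∃[ j ] a ≤ j × j ≤ a + k × j < h × m * j ≤ v ! j

  remove-skeletal : ∀ {h k c i} {x : Vec ℕ (suc h)} → i ≤ h → Skeletalℕ k c x → Skeletalℕ k (m + c) (remove i x)
  remove-skeletal {h} {k} {c} {i} {x} i≤h sx = record
    { nonDecreasing = remove-nonDecreasing i≤h nonDecreasing
    ; below         = below′
    ; reaches       = reaches′
    }
    where
      open Skeletalℕ sx
      y : Vec ℕ h
      y = remove i x
      y≥x : ∀ {j} → j < h → x ! j ≤ y ! j
      y≥x j<h = proj₁ (remove-between i≤h nonDecreasing j<h)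
      below′ : ∀ j → h ∸ suc k ≤ j → j < h → y ! j < m * j + (m + c)
      below′ j w′≤j j<h = begin-strict
        y ! j          ≤⟨ proj₂ (remove-between i≤h nonDecreasing j<h) ⟩
        x ! suc j      <⟨ below (suc j) (≤-trans (m∸n≤1+m∸[1+n] h k) (s≤s w′≤j)) (s≤s j<h) ⟩
        m * suc j + c  ≡⟨ m*[1+j]+c≡m*j+[m+c] m j c ⟩
        m * j + (m + c) ∎
        where open ≤-Reasoning
      reaches′ : ∀ a → a ≤ h ∸ suc k → a < h → ∃[ j ] a ≤ j × j ≤ a + k × j < h × m * j ≤ y ! j
      reaches′ zero    _    0<h = 0 , z≤n , z≤n , 0<h , subst (_≤ y ! 0) (sym (*-zeroʳ m)) z≤n
      reaches′ (suc a) a≤w′ _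
        with reaches (suc a) (≤-trans a≤w′ (∸-monoʳ-≤ h (n≤1+n k))) (s≤s (≤-trans a≤w′ (m∸n≤m h (suc k))))
      ... | j , a≤j , j≤a+k , _ , mj≤xj = j , a≤j , j≤a+k , j<h , ≤-trans mj≤xj (y≥x j<h)
        where
          j<h : j < h
          j<h = ≤-<-trans j≤a+k (1+m≤n∸[1+o]⇒1+m+o<n k a≤w′)

  Crosses : ∀ {n} → ℕ → Vec ℕ n → ℕ → Set
  Crosses c v j = m * j + c ≤ v ! j

  crossing : ∀ {n} → ℕ → ℕ → Vec ℕ n → ℕ
  crossing {n} c w v = first (λ j → m * j + c ≤? v ! j) w n

  crossing-FirstIn : ∀ {n c w} (v : Vec ℕ n) → w ≤ n → FirstIn (Crosses c v) w n (crossing c w v)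
  crossing-FirstIn v = first-FirstIn _

  insertCrossing : ∀ {h} → ℕ → ℕ → Vec ℕ h → Vec ℕ (suc h)
  insertCrossing {h} k c y = insert i (m * i + c) y
    where
      i : ℕ
      i = crossing c (h ∸ k) y

  module _ {h : ℕ} (k c : ℕ) (y : Vec ℕ h) where

    private
      i : ℕ
      i = crossing c (h ∸ k) y
      x : Vec ℕ (suc h)
      x = insertCrossing k c y
      open FirstIn (crossing-FirstIn {c = c} y (m∸n≤m h k))
      i≤h : i ≤ h
      i≤h = upper
      x!i : x ! i ≡ m * i + c
      x!i = insert-!-≡ i (m * i + c) y i≤h
      x!j<i : ∀ {j} → j < i → x ! j ≡ y ! j
      x!j<i = insert-!-< (m * i + c) y i≤h
      x!j>i : ∀ {j} → i ≤ j → x ! suc j ≡ y ! j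
      x!j>i = insert-!-> (m * i + c) y

    insertCrossing-¬skeletal : ¬ Skeletalℕ k c x
    insertCrossing-¬skeletal sx = <-irrefl x!i (Skeletalℕ.below sx i lower (s≤s i≤h))

    crossing-insertCrossing : crossing c (h ∸ k) x ≡ i
    crossing-insertCrossing = FirstIn-unique (crossing-FirstIn x (≤-trans (m∸n≤m h k) (n≤1+n h))) (record
      { lower  = lower
      ; upper  = ≤-trans i≤h (n≤1+n h)
      ; misses = λ w≤j j<i crosses → misses w≤j j<i (subst (m * _ + c ≤_) (x!j<i j<i) crosses)
      ; hits   = λ _ → ≤-reflexive (sym x!i)
      })

    module _ (sy : Skeletalℕ k (m + suc c) y) where

      open Skeletalℕ sy

      private
        y!j≤ : ∀ {j} → h ∸ suc k ≤ j → j < h → y ! j ≤ m * suc j + c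
        y!j≤ {j} w′≤j j<h = s≤s⁻¹ (begin-strict
          y ! j               <⟨ below j w′≤j j<h ⟩
          m * j + (m + suc c) ≡⟨ m*[1+j]+c≡m*j+[m+c] m j (suc c) ⟨
          m * suc j + suc c   ≡⟨ +-suc (m * suc j) c ⟩
          suc (m * suc j + c) ∎)
          where open ≤-Reasoning

      insertCrossing-nonDecreasing : NonDecreasing x
      insertCrossing-nonDecreasing = insert-nonDecreasing i≤h nonDecreasing left hits
        where
          left : ∀ {j} → suc j ≡ i → y ! j ≤ m * i + c
          left {j} sj≡i = subst (λ t → y ! j ≤ m * t + c) sj≡i
            (y!j≤ (m∸n≤1+o⇒m∸[1+n]≤o h k (subst (h ∸ k ≤_) (sym sj≡i) lower)) (subst (_≤ h) (sym sj≡i) i≤h))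

      insertCrossing-below : ∀ j → h ∸ k ≤ j → j < suc h → x ! j < m * j + suc c
      insertCrossing-below j w≤j _ with <-cmp j i
      ... | tri< j<i _ _  rewrite x!j<i j<i = ≤-trans (≰⇒> (misses w≤j j<i)) (+-monoʳ-≤ (m * j) (n≤1+n c))
      ... | tri≈ _ refl _ rewrite x!i      = +-monoʳ-< (m * j) (n<1+n c)
      insertCrossing-below (suc j) _ (s≤s j<h) | tri> _ _ (s≤s i≤j) rewrite x!j>i i≤j | +-suc (m * suc j) c =
        s≤s (y!j≤ (≤-trans (∸-monoʳ-≤ h (n≤1+n k)) (≤-trans lower i≤j)) j<h)

      insertCrossing-reaches : ∀ a → a ≤ h ∸ k → a < suc h →
                               ∃[ j ] a ≤ j × j ≤ a + k × j < suc h × m * j ≤ x ! j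
      insertCrossing-reaches a a≤w _ with i ≤? a + k
      ... | yes i≤a+k = i , ≤-trans a≤w lower , i≤a+k , s≤s i≤h , subst (m * i ≤_) (sym x!i) (m≤m+n (m * i) c)
      ... | no  i≰a+k with reaches a a≤w′ (≤-<-trans (m≤m+n a k) (<-≤-trans (≰⇒> i≰a+k) i≤h))
        where
          a≤w′ : a ≤ h ∸ suc k
          a≤w′ = m+n≤o⇒m≤o∸n a (subst (_≤ h) (sym (+-suc a k)) (≤-trans (≰⇒> i≰a+k) i≤h))
      ...   | j , a≤j , j≤a+k , j<h , mj≤yj =
        j , a≤j , j≤a+k , m<n⇒m<1+n j<h , subst (m * j ≤_) (sym (x!j<i (≤-<-trans j≤a+k (≰⇒> i≰a+k)))) mj≤yj

      insertCrossing-skeletal : Skeletalℕ k (suc c) x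
      insertCrossing-skeletal = record
        { nonDecreasing = insertCrossing-nonDecreasing
        ; below         = insertCrossing-below
        ; reaches       = insertCrossing-reaches
        }

    remove-insertCrossing : remove (crossing c (h ∸ k) x) x ≡ y
    remove-insertCrossing = trans (cong (λ t → remove t x) crossing-insertCrossing) (remove-insert i (m * i + c) y)

  insertCrossing-injective : ∀ {h} k c {y y′ : Vec ℕ h} → insertCrossing k c y ≡ insertCrossing k c y′ → y ≡ y′
  insertCrossing-injective {h} k c {y} {y′} eq = begin
    y                                                       ≡⟨ remove-insertCrossing k c y ⟨
    remove (crossing c (h ∸ k) x) x                         ≡⟨ cong (λ z → remove (crossing c (h ∸ k) z) z) eq ⟩
    remove (crossing c (h ∸ k) x′) x′                       ≡⟨ remove-insertCrossing k c y′ ⟩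
    y′                                                      ∎
    where
      open ≡-Reasoning
      x x′ : Vec ℕ (suc h)
      x = insertCrossing k c y
      x′ = insertCrossing k c y′

  module _ {h k c : ℕ} {x : Vec ℕ (suc h)} (sx : Skeletalℕ k (suc c) x) where

    private
      i : ℕ
      i = crossing c (h ∸ k) x
      open Skeletalℕ sx
      open FirstIn (crossing-FirstIn {c = c} x (≤-trans (m∸n≤m h k) (n≤1+n h)))

    crossing-none : i ≡ suc h → Skeletalℕ k c x
    crossing-none i≡sh = record
      { nonDecreasing = nonDecreasing
      ; below         = λ j w≤j j<sh → ≰⇒> (misses w≤j (subst (j <_) (sym i≡sh) j<sh))
      ; reaches       = reaches
      }

    crossing-hit : i ≤ h → x ! i ≡ m * i + c
    crossing-hit i≤h = ≤-antisym
      (s≤s⁻¹ (subst (x ! i <_) (+-suc (m * i) c) (below i lower (s≤s i≤h))))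
      (hits (s≤s i≤h))

    crossing-remove : i ≤ h → crossing c (h ∸ k) (remove i x) ≡ i
    crossing-remove i≤h = FirstIn-unique (crossing-FirstIn (remove i x) (m∸n≤m h k)) (record
      { lower  = lower
      ; upper  = i≤h
      ; misses = λ w≤j j<i crosses → misses w≤j j<i (subst (m * _ + c ≤_) (remove-!-< x i≤h j<i) crosses)
      ; hits   = λ i<h → begin
          m * i + c        ≡⟨ crossing-hit i≤h ⟨
          x ! i            ≤⟨ nonDecreasing i (s≤s i<h) ⟩
          x ! suc i        ≡⟨ remove-!-≥ x (≤-refl {i}) ⟨
          remove i x ! i   ∎
      })
      where open ≤-Reasoning

    insertCrossing-remove : i ≤ h → insertCrossing k c (remove i x) ≡ x
    insertCrossing-remove i≤h = begin
      insertCrossing k c (remove i x)    ≡⟨ cong (λ t → insert t (m * t + c) (remove i x)) (crossing-remove i≤h) ⟩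
      insert i (m * i + c) (remove i x)  ≡⟨ cong (λ a → insert i a (remove i x)) (crossing-hit i≤h) ⟨
      insert i (x ! i) (remove i x)      ≡⟨ insert-remove i x i≤h ⟩
      x                                  ∎
      where open ≡-Reasoning

  skeletalℕ-[] : ∀ {k c} → Skeletalℕ k c []
  skeletalℕ-[] = record { nonDecreasing = λ _ () ; below = λ _ _ () ; reaches = λ _ _ () }

  ¬skeletalℕ-zero : ∀ {h k} {x : Vec ℕ (suc h)} → ¬ Skeletalℕ k 0 x
  ¬skeletalℕ-zero {h} {k} {x} sx with Skeletalℕ.reaches sx (h ∸ k) ≤-refl (s≤s (m∸n≤m h k))
  ... | j , w≤j , _ , j<sh , mj≤xj =
    <⇒≱ (subst (x ! j <_) (+-identityʳ (m * j)) (Skeletalℕ.below sx j w≤j j<sh)) mj≤xj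

  skeletalℕ-suc : ∀ {h k c} {x : Vec ℕ h} → Skeletalℕ k c x → Skeletalℕ k (suc c) x
  skeletalℕ-suc {c = c} sx = record
    { nonDecreasing = nonDecreasing
    ; below         = λ j w≤j j<h → <-≤-trans (below j w≤j j<h) (+-monoʳ-≤ (m * j) (n≤1+n c))
    ; reaches       = reaches
    }
    where open Skeletalℕ sx

  paths : ∀ h → ℕ → ℕ → List (Vec ℕ h)
  paths zero    k c       = [ [] ]
  paths (suc h) k zero    = []
  paths (suc h) k (suc c) = paths (suc h) k c ++ map (insertCrossing k c) (paths h k (m + suc c))

  enumerates-step : ∀ {h k c} {L₁ : List (Vec ℕ (suc h))} {L₂ : List (Vec ℕ h)} →
    Enumerates L₁ (Skeletalℕ k c) → Enumerates L₂ (Skeletalℕ k (m + suc c)) →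
    Enumerates (L₁ ++ map (insertCrossing k c) L₂) (Skeletalℕ k (suc c))
  enumerates-step {h} {k} {c} {L₁} {L₂} E₁ E₂ = record
    { unique   = Unique.++⁺ (unique E₁) (Unique.map⁺ (insertCrossing-injective k c) (unique E₂)) disjoint
    ; sound    = sound′
    ; complete = complete′
    }
    where
      open Enumerates
      disjoint : ∀ {v} → ¬ (v ∈ L₁ × v ∈ map (insertCrossing k c) L₂)
      disjoint (v∈L₁ , v∈L₂′) with ∈-map⁻ (insertCrossing k c) v∈L₂′
      ... | y , _ , refl = insertCrossing-¬skeletal k c y (sound E₁ v∈L₁)
      sound′ : ∀ {v} → v ∈ L₁ ++ map (insertCrossing k c) L₂ → Skeletalℕ k (suc c) v
      sound′ v∈ with ∈-++⁻ L₁ v∈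
      ... | inj₁ v∈L₁  = skeletalℕ-suc (sound E₁ v∈L₁)
      ... | inj₂ v∈L₂′ with ∈-map⁻ (insertCrossing k c) v∈L₂′
      ...   | y , y∈L₂ , refl = insertCrossing-skeletal k c y (sound E₂ y∈L₂)
      complete′ : ∀ {v} → Skeletalℕ k (suc c) v → v ∈ L₁ ++ map (insertCrossing k c) L₂
      complete′ {v} sv
        with m≤n⇒m<n∨m≡n (FirstIn.upper (crossing-FirstIn {c = c} v (≤-trans (m∸n≤m h k) (n≤1+n h))))
      ... | inj₂ none      = ∈-++⁺ˡ (complete E₁ (crossing-none sv none))
      ... | inj₁ (s≤s i≤h) = ∈-++⁺ʳ L₁ (subst (_∈ _) (insertCrossing-remove sv i≤h)
                               (∈-map⁺ (insertCrossing k c) (complete E₂ (remove-skeletal i≤h sv))))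

  paths-enumerates : ∀ h k c → Enumerates (paths h k c) (Skeletalℕ k c)
  paths-enumerates zero    k c       = record
    { unique = [] ∷ [] ; sound = λ { {[]} _ → skeletalℕ-[] } ; complete = λ { {[]} _ → here refl } }
  paths-enumerates (suc h) k zero    = record
    { unique = [] ; sound = λ () ; complete = λ s → ⊥-elim (¬skeletalℕ-zero s) }
  paths-enumerates (suc h) k (suc c) = enumerates-step (paths-enumerates (suc h) k c) (paths-enumerates h k (m + suc c))

  length-paths : ∀ h k c → IsBallot m h c (length (paths h k c))
  length-paths zero    k c       = isBallot-zero m c
  length-paths (suc h) k zero    = refl
  length-paths (suc h) k (suc c) = subst (IsBallot m (suc h) (suc c)) (sym length-L)
    (ballot-step m h c {length L₁} (length-paths (suc h) k c) (length-paths h k (m + suc c)))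
    where
      L₁ : List (Vec ℕ (suc h))
      L₁ = paths (suc h) k c
      L₂ : List (Vec ℕ h)
      L₂ = paths h k (m + suc c)
      length-L : length (L₁ ++ map (insertCrossing k c) L₂) ≡ length L₁ + length L₂
      length-L = trans (length-++ L₁) (cong (λ u → length L₁ + u) (length-map (insertCrossing k c) L₂))

lookup-! : ∀ {n} (v : Vec ℕ n) (i : Fin n) → lookup v i ≡ v ! toℕ i
lookup-! (a ∷ v) Fin.zero    = refl
lookup-! (a ∷ v) (Fin.suc i) = lookup-! v i

toℤ : ∀ {n} → Vec ℕ n → Vec ℤ n
toℤ = Vec.map (λ a → + a)

toℤ-injective : ∀ {n} {v v′ : Vec ℕ n} → toℤ v ≡ toℤ v′ → v ≡ v′
toℤ-injective {v = v} {v′} eq = trans (sym (∣map+∣ v)) (trans (cong (Vec.map ∣_∣) eq) (∣map+∣ v′))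
  where
    ∣map+∣ : ∀ {n} (v : Vec ℕ n) → Vec.map ∣_∣ (toℤ v) ≡ v
    ∣map+∣ v = trans (sym (map-∘ ∣_∣ +_ v)) (map-id v)

toℤ-∣∣ : ∀ {n} (x : Vec ℤ n) → (∀ i → + 0 ℤ.≤ lookup x i) → toℤ (Vec.map ∣_∣ x) ≡ x
toℤ-∣∣ []      _      = refl
toℤ-∣∣ (a ∷ x) nonneg = cong₂ _∷_ (ℤ.0≤i⇒+∣i∣≡i (nonneg Fin.zero)) (toℤ-∣∣ x (nonneg ∘ Fin.suc))

skeletal-nonneg : ∀ {c m n k} (x : Vec ℤ n) → Skeletal c m n k x → ∀ i → + 0 ℤ.≤ lookup x i
skeletal-nonneg {n = suc n} _ (monotone , nonneg₀ , _) i = ℤ.≤-trans (nonneg₀ Fin.zero refl) (monotone Fin.zero i z≤n)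

module _ (m : ℕ) {n k c : ℕ} {v : Vec ℕ n} where

  open SkeletalPaths m

  private
    lookup-+ : ∀ i → lookup (toℤ v) i ≡ + (v ! toℕ i)
    lookup-+ i = trans (lookup-map i +_ v) (cong +_ (lookup-! v i))
    lookup-+-fromℕ< : ∀ {j} (j<n : j < n) → lookup (toℤ v) (fromℕ< j<n) ≡ + (v ! j)
    lookup-+-fromℕ< j<n = trans (lookup-+ _) (cong (λ j → + (v ! j)) (toℕ-fromℕ< j<n))
    +m*j+c : ∀ j → + m ℤ.* + j ℤ.+ + c ≡ + (m * j + c)
    +m*j+c j = cong (ℤ._+ + c) (sym (ℤ.pos-* m j))

  skeletalℕ⇒skeletal : Skeletalℕ k c v → Skeletal (+ c) (+ m) n k (toℤ v)
  skeletalℕ⇒skeletal sv = monotone , nonneg₀ , below′ , reaches′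
    where
      open Skeletalℕ sv
      monotone : Monotone (toℤ v)
      monotone i j i≤j = subst₂ ℤ._≤_ (sym (lookup-+ i)) (sym (lookup-+ j))
        (ℤ.+≤+ (nonDecreasing-≤ {v = v} nonDecreasing i≤j (toℕ<n j)))
      nonneg₀ : ∀ i → toℕ i ≡ 0 → + 0 ℤ.≤ lookup (toℤ v) i
      nonneg₀ i _ = subst (+ 0 ℤ.≤_) (sym (lookup-+ i)) (ℤ.+≤+ z≤n)
      below′ : ∀ i → (n ∸ k) ∸ 1 ≤ toℕ i → lookup (toℤ v) i ℤ.< + m ℤ.* + toℕ i ℤ.+ + c
      below′ i w≤i = subst₂ ℤ._<_ (sym (lookup-+ i)) (sym (+m*j+c (toℕ i)))
        (ℤ.+<+ (below (toℕ i) (subst (_≤ toℕ i) ([m∸n]∸1≡m∸[1+n] n k) w≤i) (toℕ<n i)))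
      reaches′ : ∀ i → toℕ i ≤ (n ∸ k) ∸ 1 →
                 Σ (Fin n) λ j → (toℕ i ≤ toℕ j) × (toℕ j ≤ toℕ i + k) × (+ m ℤ.* + toℕ j ℤ.≤ lookup (toℤ v) j)
      reaches′ i i≤w with reaches (toℕ i) (subst (toℕ i ≤_) ([m∸n]∸1≡m∸[1+n] n k) i≤w) (toℕ<n i)
      ... | j , i≤j , j≤i+k , j<n , mj≤vj =
        fromℕ< j<n , subst (toℕ i ≤_) (sym e) i≤j , subst (_≤ toℕ i + k) (sym e) j≤i+k ,
        subst₂ ℤ._≤_ (trans (ℤ.pos-* m j) (cong (λ t → + m ℤ.* + t) (sym e))) (sym (lookup-+-fromℕ< j<n)) (ℤ.+≤+ mj≤vj)
        where
          e : toℕ (fromℕ< j<n) ≡ j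
          e = toℕ-fromℕ< j<n

  skeletal⇒skeletalℕ : Skeletal (+ c) (+ m) n k (toℤ v) → Skeletalℕ k c v
  skeletal⇒skeletalℕ (monotone , _ , below′ , reaches′) = record
    { nonDecreasing = nonDecreasing
    ; below         = below
    ; reaches       = reaches
    }
    where
      nonDecreasing : NonDecreasing v
      nonDecreasing j sj<n = ℤ.drop‿+≤+ (subst₂ ℤ._≤_ (lookup-+-fromℕ< j<n) (lookup-+-fromℕ< sj<n)
        (monotone (fromℕ< j<n) (fromℕ< sj<n) (subst₂ _≤_ (sym (toℕ-fromℕ< j<n)) (sym (toℕ-fromℕ< sj<n)) (n≤1+n j))))
        where
          j<n : j < n
          j<n = <-trans (n<1+n j) sj<n
      below : ∀ j → n ∸ suc k ≤ j → j < n → v ! j < m * j + c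
      below j w≤j j<n = ℤ.drop‿+<+ (subst₂ ℤ._<_ (lookup-+-fromℕ< j<n)
        (trans (cong (λ t → + m ℤ.* + t ℤ.+ + c) (toℕ-fromℕ< j<n)) (+m*j+c j))
        (below′ (fromℕ< j<n) (subst₂ _≤_ (sym ([m∸n]∸1≡m∸[1+n] n k)) (sym (toℕ-fromℕ< j<n)) w≤j)))
      reaches : ∀ a → a ≤ n ∸ suc k → a < n → ∃[ j ] a ≤ j × j ≤ a + k × j < n × m * j ≤ v ! j
      reaches a a≤w a<n with reaches′ (fromℕ< a<n) (subst₂ _≤_ (sym (toℕ-fromℕ< a<n)) (sym ([m∸n]∸1≡m∸[1+n] n k)) a≤w)
      ... | j , a≤j , j≤a+k , mj≤vj =
        toℕ j , subst (_≤ toℕ j) e a≤j , subst (λ t → toℕ j ≤ t + k) e j≤a+k , toℕ<n j ,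
        ℤ.drop‿+≤+ (subst₂ ℤ._≤_ (sym (ℤ.pos-* m (toℕ j))) (lookup-+ j) mj≤vj)
        where
          e : toℕ (fromℕ< a<n) ≡ a
          e = toℕ-fromℕ< a<n

skeletal-paths : ∀ m n k c → Enumerates (map toℤ (SkeletalPaths.paths m n k c)) (Skeletal (+ c) (+ m) n k)
skeletal-paths m n k c = enumerates-map toℤ-injective (skeletalℕ⇒skeletal m) natural (paths-enumerates n k c)
  where
    open SkeletalPaths m
    natural : ∀ {x} → Skeletal (+ c) (+ m) n k x → ∃[ v ] Skeletalℕ k c v × toℤ v ≡ x
    natural {x} sx = Vec.map ∣_∣ x , skeletal⇒skeletalℕ m (subst (Skeletal (+ c) (+ m) n k) (sym x≡) sx) , x≡
      where
        x≡ : toℤ (Vec.map ∣_∣ x) ≡ x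
        x≡ = toℤ-∣∣ x (skeletal-nonneg {+ c} {+ m} x sx)

corollary2p2 : (n c m k : ℕ) → 0 < n → 0 < c → k < n →
    Σ (List (Vec ℤ n)) λ L →
      Unique L
      × ((x : Vec ℤ n) → (x ∈ L) ⇔ Skeletal (+ c) (+ m) n k x)
      × (length L * ((suc m) * n + c) ≡ c * (((suc m) * n + c) C n))
corollary2p2 n c m k _ _ _ =
  map toℤ (paths n k c) , unique , (λ _ → mk⇔ sound complete) ,
  trans (cong (_* (suc m * n + c)) (length-map toℤ (paths n k c))) (length-paths n k c)
  where
    open SkeletalPaths m
    open Enumerates (skeletal-paths m n k c)
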